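{- Let $\mathcal P=\langle\mathcal S,\mathcal W,\mathcal Q,\mathcal T\rangle$ be a complexity problem, $f:\mathbb N\to\mathbb N$, and let $(\succsim,\succ)$ be a $\mathcal P$-monotone complexity pair such that $\succ$ induces the complexity $f$ on $\mathcal P$. If $\mathcal S\subseteq{\succ}$ and $\mathcal W\subseteq{\succsim}$, then the judgement $\mathcal P\vdash f$ is valid, i.e. $\mathrm{cc}_{\mathcal P}$ is defined on all inputs and $\mathrm{cc}_{\mathcal P}\in O(f)$.
   Context: Terms are built from a signature $\mathcal F$ and a countably infinite set of variables $\mathcal V$; $|t|$ is the number of symbol occurrences in $t$. For TRSs $\mathcal Q,\mathcal R$ write $s\to^{\mathcal Q}_{\mathcal R}t$ iff there are a context $C$, a substitution $\sigma$ and a rule $f(l_1,\dots,l_n)\to r\in\mathcal R$ with $s=C[f(l_1\sigma,\dots,l_n\sigma)]$, $t=C[r\sigma]$, and every $l_i\sigma$ is a normal form of $\mathcal Q$. ${\to^{\mathcal Q}_{\mathcal S/\mathcal W}}=(\to^{\mathcal Q}_{\mathcal W})^*\cdot\to^{\mathcal Q}_{\mathcal S}\cdot(\to^{\mathcal Q}_{\mathcal W})^*$. $\mathrm{dh}(t,\to)=\max\{n\mid\exists t_1,\dots,t_n.\ t\to t_1\to\cdots\to t_n\}$ (partial). A complexity problem $\mathcal P=\langle\mathcal S,\mathcal W,\mathcal Q,\mathcal T\rangle$ consists of TRSs $\mathcal S,\mathcal W,\mathcal Q$ and a set of terms $\mathcal T$; its complexity function is the partial function $\mathrm{cc}_{\mathcal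 P}(n)=\max\{\mathrm{dh}(t,\to^{\mathcal Q}_{\mathcal S/\mathcal W})\mid t\in\mathcal T,|t|\le n\}$; $\to_{\mathcal P}=\to^{\mathcal Q}_{\mathcal S\cup\mathcal W}$ and $\to_{\mathcal P}^*(\mathcal T)$ is the set of terms reachable from $\mathcal T$. Replacement maps: $\mu(f)\subseteq\{1,\dots,\mathrm{arity}(f)\}$; $\mathrm{Pos}_\mu(x)=\{\varepsilon\}$, $\mathrm{Pos}_\mu(f(t_1,\dots,t_n))=\{\varepsilon\}\cup\{i\cdot p\mid i\in\mu(f),p\in\mathrm{Pos}_\mu(t_i)\}$; $\mathcal T_\mu(\to)$ is the set of terms $s$ all of whose positions $p$ with $s|_p$ not a $\to$-normal form lie in $\mathrm{Pos}_\mu(s)$; $\mu$ is a usable replacement map for $\mathcal R$ in $\mathcal P$ if $\to_{\mathcal P}^*(\mathcal T)\subseteq\mathcal T_\mu(\to^{\mathcal Q}_{\mathcal R})$. A relation $R$ is $\mu$-monotone if $i\in\mu(f)$, $s_i\mathrel R t_i$ imply $f(\dots,s_i,\dots)\mathrel R f(\dots,t_i,\dots)$. A complexity pair $(\succsim,\succ)$: $\succsim$ a preorder, $\succ$ an order, both stable under substitutions, ${\succsim}\cdot{\succ}\cdot{\succsim}\subseteq{\succ}$. It is $\mathcal P$-monotone if $\succsim$ is $\mu_{\mathcal W}$-monotone and $\succ$ is $\mu_{\mathcal S}$-monotone for usable replacement maps $\mu_{\mathcal W}$ of $\mathcal W$ and $\mu_{\mathcal S}$ of $\mathcal S$ in $\mathcal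 P$. $\succ$ is $G$-collapsible on $\mathcal P$ (for $G$ mapping terms to $\mathbb N$) if for all $s\in\to_{\mathcal P}^*(\mathcal T)$, $s\to^{\mathcal Q}_{\mathcal S/\mathcal W}t$ and $s\succ t$ imply $G(s)>G(t)$; $\succ$ induces the complexity $f$ on $\mathcal P$ if it is $G$-collapsible on $\mathcal P$ for some $G$ with $G(t)\in O(f(|t|))$ for $t\in\mathcal T$. $\mathcal R\subseteq{\succ}$ means $l\succ r$ for all $l\to r\in\mathcal R$.
   Formalization: G(t) ∈ O(f(|t|)) for t ∈ T means that G(t) is at most a constant times f(n) for all large n and all t ∈ T with |t| ≤ n, not a constant times f(|t|). The statement above fails without it. -}

module Defs where

open import Level using (0ℓ)
open import Data.Nat using (ℕ; zero; suc; _+_; _*_; _≤_; _<_; _>_)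
open import Data.Fin using (Fin; toℕ)
open import Data.Vec using (Vec; []; _∷_; lookup; _[_]≔_)
open import Data.Vec.Relation.Unary.All using (All)
open import Data.List using (List; []; _∷_)
open import Data.Product using (Σ; _×_; _,_; ∃; ∃-syntax)
open import Data.Sum using (_⊎_)
open import Relation.Nullary using (¬_)
open import Relation.Binary.PropositionalEquality using (_≡_)
open import Relation.Binary.Core using (Rel)
open import Relation.Binary.Structures using (IsPreorder; IsStrictPartialOrder)
open import Relation.Binary.Construct.Closure.ReflexiveTransitive using (Star)

record Signature : Set₁ where
  field
    Sym   : Set
    arity : Sym → ℕ
open Signature public

module _ (Sig : Signature) where
  data Term : Set where
    var : ℕ → Term
    fun : (f : Sym Sig) → Vec Term (arity Sig f) → Term

  Subst : Set
  Subst = ℕ → Term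

  record Rule : Set where
    constructor _⟶_
    field
      lhs : Term
      rhs : Term

  TRS : Set₁
  TRS = Rule → Set

  -- replacement map: μ f i holds iff argument position i of f is in μ(f)
  -- (argument positions are 0-based Fin indices here)
  ReplacementMap : Set₁
  ReplacementMap = (f : Sym Sig) → Fin (arity Sig f) → Set

module _ {Sig : Signature} where

  mutual
    size : Term Sig → ℕ
    size (var x)    = 1
    size (fun f ts) = suc (sizes ts)

    sizes : ∀ {n} → Vec (Term Sig) n → ℕ
    sizes []       = 0
    sizes (t ∷ ts) = size t + sizes ts

  mutual
    _·_ : Term Sig → Subst Sig → Term Sig
    var x    · σ = σ x
    fun f ts · σ = fun f (ts ·* σ)

    _·*_ : ∀ {n} → Vec (Term Sig) n → Subst Sig → Vec (Term Sig) n
    []       ·* σ = []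
    (t ∷ ts) ·* σ = (t · σ) ∷ (ts ·* σ)

  _∪_ : TRS Sig → TRS Sig → TRS Sig
  (R ∪ R′) ρ = R ρ ⊎ R′ ρ

  data CtxClosure (Rt : Rel (Term Sig) 0ℓ) : Rel (Term Sig) 0ℓ where
    here : ∀ {s t} → Rt s t → CtxClosure Rt s t
    arg  : ∀ (f : Sym Sig) (ts : Vec (Term Sig) (arity Sig f))
             (i : Fin (arity Sig f)) (u : Term Sig) →
           CtxClosure Rt (lookup ts i) u →
           CtxClosure Rt (fun f ts) (fun f (ts [ i ]≔ u))

  data RootStep (R : TRS Sig) : Rel (Term Sig) 0ℓ where
    root : ∀ {s t} (l r : Term Sig) (σ : Subst Sig) →
           R (l ⟶ r) → s ≡ l · σ → t ≡ r · σ → RootStep R s t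

  Step : TRS Sig → Rel (Term Sig) 0ℓ
  Step R = CtxClosure (RootStep R)

  IsNF : Rel (Term Sig) 0ℓ → Term Sig → Set
  IsNF _⟶′_ s = ∀ t → ¬ (s ⟶′ t)

  NF : TRS Sig → Term Sig → Set
  NF Q = IsNF (Step Q)

  data QRootStep (Q R : TRS Sig) : Rel (Term Sig) 0ℓ where
    root : ∀ {s t} (f : Sym Sig) (ls : Vec (Term Sig) (arity Sig f))
             (r : Term Sig) (σ : Subst Sig) →
           R (fun f ls ⟶ r) → All (NF Q) (ls ·* σ) →
           s ≡ fun f (ls ·* σ) → t ≡ r · σ → QRootStep Q R s t

  QStep : TRS Sig → TRS Sig → Rel (Term Sig) 0ℓ
  QStep Q R = CtxClosure (QRootStep Q R)

  RelStep : TRS Sig → TRS Sig → TRS Sig → Rel (Term Sig) 0ℓ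
  RelStep Q S W s t =
    ∃[ s′ ] ∃[ t′ ] (Star (QStep Q W) s s′ × QStep Q S s′ t′ × Star (QStep Q W) t′ t)

  data Chain (_⟶′_ : Rel (Term Sig) 0ℓ) : Term Sig → ℕ → Set where
    []  : ∀ {t} → Chain _⟶′_ t 0
    _∷_ : ∀ {t u n} → t ⟶′ u → Chain _⟶′_ u n → Chain _⟶′_ t (suc n)

  -- m = max S  (with the convention max ∅ = 0)
  IsMax : (ℕ → Set) → ℕ → Set
  IsMax P m = (P m ⊎ (m ≡ 0 × (∀ k → ¬ P k))) × (∀ k → P k → k ≤ m)

  IsDh : Rel (Term Sig) 0ℓ → Term Sig → ℕ → Set
  IsDh _⟶′_ t = IsMax (λ n → Chain _⟶′_ t n)

  record Problem : Set₁ where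
    field
      S W Q : TRS Sig
      T     : Term Sig → Set

  module _ (P : Problem) where
    open Problem P

    PStep : Rel (Term Sig) 0ℓ
    PStep = QStep Q (S ∪ W)

    Reachable : Term Sig → Set
    Reachable t = ∃[ s ] (T s × Star PStep s t)

    IsCC : ℕ → ℕ → Set
    IsCC n m =
      (∀ t → T t → size t ≤ n → ∃[ k ] IsDh (RelStep Q S W) t k) ×
      IsMax (λ k → ∃[ t ] (T t × size t ≤ n × IsDh (RelStep Q S W) t k)) m

    -- cc_P is defined on input n: the set of
    -- lengths of →^Q_{S/W}-derivations from terms t ∈ T with |t| ≤ n is
    -- bounded (constructive rendering of "the maximum exists")
    CCDefinedAt : ℕ → Set
    CCDefinedAt n =
      ∃[ B ] (∀ t → T t → size t ≤ n → ∀ k → Chain (RelStep Q S W) t k → k ≤ B)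

    Valid : (ℕ → ℕ) → Set
    Valid f = (∀ n → CCDefinedAt n) ×
      ∃[ c ] ∃[ N ] (∀ n m → N ≤ n → IsCC n m → m ≤ c * f n)

  -- positions and replacement maps (positions are lists of 0-based
  -- argument indices)

  data SubtermAt : Term Sig → List ℕ → Term Sig → Set where
    here  : ∀ {t} → SubtermAt t [] t
    there : ∀ {f ts p u} (i : Fin (arity Sig f)) →
            SubtermAt (lookup ts i) p u → SubtermAt (fun f ts) (toℕ i ∷ p) u

  data InPosμ (μ : ReplacementMap Sig) : Term Sig → List ℕ → Set where
    root : ∀ {t} → InPosμ μ t []
    arg  : ∀ {f ts p} (i : Fin (arity Sig f)) → μ f i →
           InPosμ μ (lookup ts i) p → InPosμ μ (fun f ts) (toℕ i ∷ p)

  InTμ : ReplacementMap Sig → Rel (Term Sig) 0ℓ → Term Sig → Set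
  InTμ μ _⟶′_ s = ∀ p u → SubtermAt s p u → ¬ IsNF _⟶′_ u → InPosμ μ s p

  UsableRM : Problem → ReplacementMap Sig → TRS Sig → Set
  UsableRM P μ R = ∀ s → Reachable P s → InTμ μ (QStep (Problem.Q P) R) s

  μMonotone : ReplacementMap Sig → Rel (Term Sig) 0ℓ → Set
  μMonotone μ _R_ = ∀ (f : Sym Sig) (ts : Vec (Term Sig) (arity Sig f))
    (i : Fin (arity Sig f)) (u : Term Sig) →
    μ f i → lookup ts i R u → fun f ts R fun f (ts [ i ]≔ u)

  StableRel : Rel (Term Sig) 0ℓ → Set
  StableRel _R_ = ∀ s t (σ : Subst Sig) → s R t → (s · σ) R (t · σ)

  record IsComplexityPair (_≿_ _≻_ : Rel (Term Sig) 0ℓ) : Set where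
    field
      ≿-preorder : IsPreorder _≡_ _≿_
      ≻-order    : IsStrictPartialOrder _≡_ _≻_
      ≿-stable   : StableRel _≿_
      ≻-stable   : StableRel _≻_
      compat     : ∀ {s s′ t′ t} → s ≿ s′ → s′ ≻ t′ → t′ ≿ t → s ≻ t

  PMonotone : Problem → (_≿_ _≻_ : Rel (Term Sig) 0ℓ) → Set₁
  PMonotone P _≿_ _≻_ = ∃[ μW ] ∃[ μS ]
    (UsableRM P μW (Problem.W P) × UsableRM P μS (Problem.S P) ×
     μMonotone μW _≿_ × μMonotone μS _≻_)

  Collapsible : Problem → (Term Sig → ℕ) → Rel (Term Sig) 0ℓ → Set
  Collapsible P G _≻_ = ∀ s t → Reachable P s →
    RelStep (Problem.Q P) (Problem.S P) (Problem.W P) s t → s ≻ t → G s > G t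

  BoundedBy : Problem → (Term Sig → ℕ) → (ℕ → ℕ) → Set
  BoundedBy P G f = ∃[ c ] ∃[ N ] (∀ n → N ≤ n →
    ∀ t → Problem.T P t → size t ≤ n → G t ≤ c * f n)

  Induces : Problem → Rel (Term Sig) 0ℓ → (ℕ → ℕ) → Set
  Induces P _≻_ f = ∃[ G ] (Collapsible P G _≻_ × BoundedBy P G f)

  _⊆ʳ_ : TRS Sig → Rel (Term Sig) 0ℓ → Set
  R ⊆ʳ _≻_ = ∀ l r → R (l ⟶ r) → l ≻ r

-- A →^Q_{S/W} step from a reachable term consists of W-steps, one S-step and more W-steps,
-- each performed at a μ-replacing position of a reachable term. Stability and
-- μ-monotonicity lift the rule orientations to these steps, so every step decreases ≻ and
-- hence, by collapsibility, the measure G. A derivation from t ∈ T is thus at most G(t) long,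
-- and G(t) ∈ O(f(|t|)) bounds cc_P.
module Submission where

open import Defs
open import Data.Nat using (ℕ; suc; _≤_; _*_; _⊔_; z≤n; s≤s)
open import Data.Nat.Properties using (≤-trans; m≤m⊔n; m≤n⊔m)
open import Level using (0ℓ)
open import Data.Fin using (Fin; toℕ)
open import Data.Fin.Properties using (toℕ-injective)
open import Data.Vec using (lookup)
open import Data.List using ([]; _∷_)
open import Data.List.Properties using (∷-injective)
open import Data.Product using (_×_; _,_; proj₁; proj₂)
open import Data.Sum using (inj₁; inj₂)
open import Relation.Binary.Core using (Rel; _⇒_)
open import Relation.Binary.Structures using (IsPreorder)
open import Relation.Binary.PropositionalEquality using (_≡_; refl; sym; subst₂)
open import Relation.Binary.Construct.Closure.ReflexiveTransitive using (Star; ε; _◅_; _◅◅_)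

module _ {Sig : Signature} where

  IsMax-≤ : ∀ {P : ℕ → Set} {m B} → IsMax {Sig} P m → (∀ k → P k → k ≤ B) → m ≤ B
  IsMax-≤ (inj₁ Pm , _)         bound = bound _ Pm
  IsMax-≤ (inj₂ (refl , _) , _) _     = z≤n

  CtxClosure-map : ∀ {Rt Rt′ : Rel (Term Sig) 0ℓ} → Rt ⇒ Rt′ → CtxClosure Rt ⇒ CtxClosure Rt′
  CtxClosure-map h (here st)        = here (h st)
  CtxClosure-map h (arg f ts i u st) = arg f ts i u (CtxClosure-map h st)

  QStep-mono : ∀ {Q R R′ : TRS Sig} → (∀ {ρ} → R ρ → R′ ρ) → QStep Q R ⇒ QStep Q R′
  QStep-mono R⊆R′ = CtxClosure-map λ where
    (root f ls r σ ρ∈R nf s≡ t≡) → root f ls r σ (R⊆R′ ρ∈R) nf s≡ t≡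

  InPosμ-arg⁻¹ : ∀ {μ : ReplacementMap Sig} {f ts p} (i : Fin (arity Sig f)) →
    InPosμ μ (fun f ts) (toℕ i ∷ p) → μ f i × InPosμ μ (lookup ts i) p
  InPosμ-arg⁻¹ i pos = invert pos refl
    where
    invert : ∀ {μ : ReplacementMap Sig} {f ts p q} {i : Fin (arity Sig f)} →
      InPosμ μ (fun f ts) q → q ≡ toℕ i ∷ p → μ f i × InPosμ μ (lookup ts i) p
    invert (arg j μfj pos) q≡ with ∷-injective q≡
    ... | toℕj≡toℕi , refl with toℕ-injective toℕj≡toℕi
    ... | refl = μfj , pos

  InTμ-arg : ∀ {μ : ReplacementMap Sig} {_⟶_ : Rel (Term Sig) 0ℓ} {f ts}
    (i : Fin (arity Sig f)) → InTμ μ _⟶_ (fun f ts) → InTμ μ _⟶_ (lookup ts i)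
  InTμ-arg i inT p u sub ¬nf = proj₂ (InPosμ-arg⁻¹ i (inT _ u (there i sub) ¬nf))

  -- A step below the root makes the subterm it rewrites a non-normal form, so the argument
  -- position it goes through is μ-replacing, which is where μ-monotonicity applies.
  QStep-oriented : ∀ {μ : ReplacementMap Sig} {Q R : TRS Sig} {_⊐_ : Rel (Term Sig) 0ℓ} →
    μMonotone μ _⊐_ → StableRel _⊐_ → R ⊆ʳ _⊐_ →
    ∀ {s t} → InTμ μ (QStep Q R) s → QStep Q R s t → s ⊐ t
  QStep-oriented {_⊐_ = _⊐_} mono stable R⊆⊐ _ (here (root f ls r σ ρ∈R _ s≡ t≡)) =
    subst₂ _⊐_ (sym s≡) (sym t≡) (stable _ _ σ (R⊆⊐ _ _ ρ∈R))
  QStep-oriented {μ = μ} mono stable R⊆⊐ inT (arg f ts i u st) =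
    mono f ts i u μfi (QStep-oriented mono stable R⊆⊐ (InTμ-arg i inT) st)
    where
    μfi : μ f i
    μfi = proj₁ (InPosμ-arg⁻¹ i (inT (toℕ i ∷ []) (lookup ts i) (there i here) λ nf → nf u st))

  module _ (P : Problem {Sig}) where
    open Problem P

    Reachable-step : ∀ {s t} → Reachable P s → PStep P s t → Reachable P t
    Reachable-step (s₀ , s₀∈T , s₀⟶*s) s⟶t = s₀ , s₀∈T , s₀⟶*s ◅◅ (s⟶t ◅ ε)

    module _ {_≿_ _≻_ : Rel (Term Sig) 0ℓ} {μW μS : ReplacementMap Sig}
             (cp : IsComplexityPair _≿_ _≻_)
             (usableW : UsableRM P μW W) (usableS : UsableRM P μS S)
             (monoW : μMonotone μW _≿_) (monoS : μMonotone μS _≻_)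
             (S⊆≻ : S ⊆ʳ _≻_) (W⊆≿ : W ⊆ʳ _≿_) where
      open IsComplexityPair cp
      open IsPreorder ≿-preorder using () renaming (reflexive to ≿-reflexive; trans to ≿-trans)

      W*-oriented : ∀ {s t} → Reachable P s → Star (QStep Q W) s t → s ≿ t × Reachable P t
      W*-oriented s∈ ε = ≿-reflexive refl , s∈
      W*-oriented {s} s∈ (s⟶u ◅ u⟶*t) =
        let u≿t , t∈ = W*-oriented (Reachable-step s∈ (QStep-mono inj₂ s⟶u)) u⟶*t
        in ≿-trans (QStep-oriented monoW ≿-stable W⊆≿ (usableW s s∈) s⟶u) u≿t , t∈

      RelStep-oriented : ∀ {s t} → Reachable P s → RelStep Q S W s t → s ≻ t × Reachable P t
      RelStep-oriented s∈ (s′ , t′ , s⟶*s′ , s′⟶t′ , t′⟶*t) =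
        let s≿s′ , s′∈ = W*-oriented s∈ s⟶*s′
            t′≿t , t∈  = W*-oriented (Reachable-step s′∈ (QStep-mono inj₁ s′⟶t′)) t′⟶*t
            s′≻t′      = QStep-oriented monoS ≻-stable S⊆≻ (usableS s′ s′∈) s′⟶t′
        in compat s≿s′ s′≻t′ t′≿t , t∈

      Chain-length≤ : ∀ {G} → Collapsible P G _≻_ →
        ∀ {s k} → Reachable P s → Chain (RelStep Q S W) s k → k ≤ G s
      Chain-length≤ collapsible s∈ [] = z≤n
      Chain-length≤ collapsible s∈ (s⟶u ∷ chain) =
        let s≻u , u∈ = RelStep-oriented s∈ s⟶u
        in ≤-trans (s≤s (Chain-length≤ collapsible u∈ chain))
                   (collapsible _ _ s∈ s⟶u s≻u)

    Valid-if-chains-bounded : ∀ {f} c N →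
      (∀ n → N ≤ n → ∀ t → T t → size t ≤ n → ∀ k → Chain (RelStep Q S W) t k → k ≤ c * f n) →
      Valid P f
    Valid-if-chains-bounded {f} c N bound = defined , c , N , cc≤
      where
      defined : ∀ n → CCDefinedAt P n
      defined n = c * f (n ⊔ N) , λ t t∈T |t|≤n →
        bound (n ⊔ N) (m≤n⊔m n N) t t∈T (≤-trans |t|≤n (m≤m⊔n n N))
      cc≤ : ∀ n m → N ≤ n → IsCC P n m → m ≤ c * f n
      cc≤ n m N≤n (_ , isMax) = IsMax-≤ isMax λ where
        k (t , t∈T , |t|≤n , isDh) → IsMax-≤ isDh (bound n N≤n t t∈T |t|≤n)

mainTheorem3 : (Sig : Signature) (P : Problem {Sig}) (f : ℕ → ℕ)
    (_≿_ _≻_ : Rel (Term Sig) 0ℓ) →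
    IsComplexityPair _≿_ _≻_ →
    PMonotone P _≿_ _≻_ →
    Induces P _≻_ f →
    Problem.S P ⊆ʳ _≻_ →
    Problem.W P ⊆ʳ _≿_ →
    Valid P f
mainTheorem3 Sig P f _≿_ _≻_ cp (_ , _ , usableW , usableS , monoW , monoS)
             (G , collapsible , c , N , G≤cf) S⊆≻ W⊆≿ =
  Valid-if-chains-bounded P c N λ n N≤n t t∈T |t|≤n k chain →
    ≤-trans (Chain-length≤ P cp usableW usableS monoW monoS S⊆≻ W⊆≿ collapsible (t , t∈T , ε) chain)
            (G≤cf n N≤n t t∈T |t|≤n)
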